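{- Let $G$ be a finite directed weighted graph on nodes $\{1,\dots,n\}$ without loops with positive edge weights and adjacency matrix $A$, whose $m$ edges are labelled $1,\dots,m$. Let $L,R\in\mathbb{R}^{m\times n}$ be the source and target matrices, $Z$ the edge-weight matrix, $W$ the weighted line-graph matrix and $B$ the weighted Hashimoto matrix. Let $p_k(A)$ denote the matrix whose $(i,j)$ entry is the sum of the weights of all nonbacktracking walks of length $k$ from node $i$ to node $j$. Then for all integers $k\ge 0$, \[ L^T\sqrt{Z}\,(B^{\circ 1/2})^k\sqrt{Z}\,R = p_{k+1}(A). \]
   Context: $L_{ej}=1$ if edge $e$ starts at node $j$, else $0$; $R_{ej}=1$ if edge $e$ ends at node $j$, else $0$. $Z$ is the $m\times m$ diagonal matrix with $Z_{ee}=A_{ij}$ when edge $e$ is $(i,j)$. $W_{ef}=A_{ij}A_{jk}$ if $e=(i,j)$ and $f=(j,k)$, and $W_{ef}=0$ otherwise. $B\in\mathbb{R}^{m\times m}$ is given by $B_{ef}=0$ if $W_{ef}W_{fe}\neq 0$ and $B_{ef}=W_{ef}$ otherwise. $X^{\circ 1/2}$ is the elementwise square root; $(B^{\circ 1/2})^0=I$. A walk (node sequence $i_1,\dots,i_{\ell+1}$ with consecutive pairs being edges) has weight equal to the product of its edge weights and is nonbacktracking if it contains no consecutive subsequence $i\,j\,i$. -}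

module Defs where

open import Level using (Level; _⊔_)
open import Algebra.Bundles using (CommutativeRing)
open import Data.Nat as ℕ using (ℕ; zero; suc)
open import Data.Fin using (Fin; _≟_)
open import Data.Fin.Properties using (any?)
open import Data.Vec using (Vec; []; _∷_; head; last)
open import Data.List using (List; []; _∷_; [_]; map; concatMap; allFin; filter; foldr)
open import Data.Product using (Σ; ∃; _×_; _,_)
open import Data.Unit.Polymorphic using (⊤)
open import Data.Bool using (if_then_else_; _∧_)
open import Relation.Nullary using (¬_; Dec; yes; no; does)
open import Relation.Nullary.Decidable using (_×-dec_; ¬?)
open import Relation.Binary.PropositionalEquality using (_≡_; _≢_)

module WithRing {c ℓ : Level} (ℛ : CommutativeRing c ℓ) where
  open CommutativeRing ℛ

  Σ[<_] : ∀ k → (Fin k → Carrier) → Carrier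
  Σ[< zero ] f = 0#
  Σ[< suc k ] f = f Fin.zero + Σ[< k ] (λ i → f (Fin.suc i))
    where import Data.Fin as Fin

  sumL : List Carrier → Carrier
  sumL = foldr _+_ 0#

  Mat : ℕ → ℕ → Set c
  Mat a b = Fin a → Fin b → Carrier

  _⊗_ : ∀ {a b d} → Mat a b → Mat b d → Mat a d
  (M ⊗ N) i j = Σ[< _ ] (λ l → M i l * N l j)

  transpose : ∀ {a b} → Mat a b → Mat b a
  transpose M i j = M j i

  idMat : ∀ {a} → Mat a a
  idMat i j = if does (i ≟ j) then 1# else 0#

  _^^_ : ∀ {a} → Mat a a → ℕ → Mat a a
  M ^^ zero = idMat
  M ^^ suc k = M ⊗ (M ^^ k)

  -- Elementwise application (used for the Hadamard square root X^{∘1/2}).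
  elementwise : ∀ {a b} → (Carrier → Carrier) → Mat a b → Mat a b
  elementwise f M i j = f (M i j)

  _≋_ : ∀ {a b} → Mat a b → Mat a b → Set ℓ
  M ≋ N = ∀ i j → M i j ≈ N i j

  -- Distinct labels give distinct (source,target) pairs (the graph is
  -- described by an adjacency matrix, so no multi-edges).
  record WeightedDigraph (n : ℕ) : Set c where
    field
      m      : ℕ
      src    : Fin m → Fin n
      tgt    : Fin m → Fin n
      w      : Fin m → Carrier
      noLoop : ∀ e → src e ≢ tgt e
      simple : ∀ e f → src e ≡ src f → tgt e ≡ tgt f → e ≡ f

  module _ {n : ℕ} (G : WeightedDigraph n) where
    open WeightedDigraph G

    adj : Mat n n
    adj i j = Σ[< m ] (λ e → if does (src e ≟ i) ∧ does (tgt e ≟ j) then w e else 0#)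

    Lmat : Mat m n
    Lmat e j = if does (src e ≟ j) then 1# else 0#

    Rmat : Mat m n
    Rmat e j = if does (tgt e ≟ j) then 1# else 0#

    Zmat : Mat m m
    Zmat e f = if does (e ≟ f) then adj (src e) (tgt e) else 0#

    sqrtZ : (Carrier → Carrier) → Mat m m
    sqrtZ √ e f = if does (e ≟ f) then √ (adj (src e) (tgt e)) else 0#

    Wmat : Mat m m
    Wmat e f = if does (tgt e ≟ src f)
               then adj (src e) (tgt e) * adj (src f) (tgt f) else 0#

    -- Weighted Hashimoto matrix B: B_ef = 0 if W_ef W_fe ≠ 0, i.e. (weights
    -- being positive) if e=(i,j) and f=(j,i); otherwise B_ef = W_ef.
    Bmat : Mat m m
    Bmat e f = if does (tgt e ≟ src f) ∧ does (tgt f ≟ src e) then 0# else Wmat e f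

    IsEdge : Fin n → Fin n → Set
    IsEdge i j = ∃ λ e → src e ≡ i × tgt e ≡ j

    isEdge? : ∀ i j → Dec (IsEdge i j)
    isEdge? i j = any? (λ e → (src e ≟ i) ×-dec (tgt e ≟ j))

    IsWalk : ∀ {l} → Vec (Fin n) l → Set
    IsWalk []            = ⊤
    IsWalk (x ∷ [])      = ⊤
    IsWalk (x ∷ y ∷ xs)  = IsEdge x y × IsWalk (y ∷ xs)

    isWalk? : ∀ {l} (v : Vec (Fin n) l) → Dec (IsWalk v)
    isWalk? []           = yes _
    isWalk? (x ∷ [])     = yes _
    isWalk? (x ∷ y ∷ xs) = isEdge? x y ×-dec isWalk? (y ∷ xs)

    NonBacktracking : ∀ {l} → Vec (Fin n) l → Set
    NonBacktracking (x ∷ y ∷ z ∷ xs) = x ≢ z × NonBacktracking (y ∷ z ∷ xs)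
    NonBacktracking _                = ⊤

    nonBacktracking? : ∀ {l} (v : Vec (Fin n) l) → Dec (NonBacktracking v)
    nonBacktracking? (x ∷ y ∷ z ∷ xs) = ¬? (x ≟ z) ×-dec nonBacktracking? (y ∷ z ∷ xs)
    nonBacktracking? []               = yes _
    nonBacktracking? (x ∷ [])         = yes _
    nonBacktracking? (x ∷ y ∷ [])     = yes _

    walkWeight : ∀ {l} → Vec (Fin n) l → Carrier
    walkWeight (x ∷ y ∷ xs) = adj x y * walkWeight (y ∷ xs)
    walkWeight _            = 1#

    allSeqs : ∀ l → List (Vec (Fin n) l)
    allSeqs zero    = [ [] ]
    allSeqs (suc l) = concatMap (λ x → map (x ∷_) (allSeqs l)) (allFin n)

    -- p_k(A)_{ij}: sum of the weights of all nonbacktracking walks of length k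
    -- (node sequences i = i_1, …, i_{k+1} = j) from i to j.
    pMat : ℕ → Mat n n
    pMat k i j = sumL (map walkWeight (filter
      (λ v → (head v ≟ i) ×-dec ((last v ≟ j) ×-dec (isWalk? v ×-dec nonBacktracking? v)))
      (allSeqs (suc k))))

-- Let N_l(x₀, x₁, j) be the total weight of the walks of length l from x₁ to j
-- that stay nonbacktracking when preceded by x₀.  Splitting off the first step
-- gives N_{l+1}(x₀, x₁, j) = Σ_{y ≠ x₀} A_{x₁y} N_l(x₁, y, j), and the same
-- split shows p_{k+1}(A)_{ij} = Σ_y A_{iy} N_k(i, y, j).  On the matrix side,
-- (B^{∘1/2})_{ef} = √w_e √w_f when f continues e without reversing it and 0
-- otherwise, so multiplying by B^{∘1/2} performs exactly this first-step
-- recursion; by induction on k, ((B^{∘1/2})^k √Z R)_{ej} = √w_e N_k(src e, tgt e, j).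
-- Finally Lᵀ √Z turns √w_e² into w_e and sums over the edges leaving i, which
-- is Σ_y A_{iy} N_k(i, y, j) again.

module Submission where

open import Defs
open import Level using (Level)
open import Algebra.Bundles using (CommutativeRing)
open import Data.Bool using (Bool; true; false; if_then_else_; _∧_)
open import Data.Bool.Properties using (∧-identityʳ; if-∧; if-cong)
open import Data.Empty using (⊥-elim)
open import Data.Fin using (Fin; zero; suc; _≟_)
open import Data.List using (List; []; _∷_; _++_; map; filter; concatMap; tabulate; allFin)
open import Data.List.Properties using (map-++; map-tabulate; map-cong; map-∘)
open import Data.Nat using (ℕ; zero; suc)
open import Data.Product using (_,_)
open import Data.Vec using (Vec; []; _∷_; head; last)
open import Function using (_∘_; id)
open import Relation.Binary.PropositionalEquality as ≡ using (_≡_)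
open import Relation.Nullary using (Dec; yes; no; does; ¬_)
open import Relation.Nullary.Decidable using (dec-true; dec-false; _×-dec_)
open import Relation.Unary using (Decidable)

does-≟-sym : ∀ {k} (a b : Fin k) → does (a ≟ b) ≡ does (b ≟ a)
does-≟-sym a b with a ≟ b
... | yes a≡b = ≡.sym (dec-true (b ≟ a) (≡.sym a≡b))
... | no a≢b = ≡.sym (dec-false (b ≟ a) (a≢b ∘ ≡.sym))

module Summation {c ℓ} (ℛ : CommutativeRing c ℓ) where
  open CommutativeRing ℛ hiding (zero)
  open WithRing ℛ
  open import Algebra.Properties.Semiring.Sum semiring
    using (sum; sum-cong-≋; sum-cong-≗; sum-replicate-zero; ∑-comm; *-distribˡ-sum; *-distribʳ-sum)
  open import Relation.Binary.Reasoning.Setoid setoid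

  Σ≡sum : ∀ {k} (f : Fin k → Carrier) → Σ[< k ] f ≡ sum f
  Σ≡sum {zero}  f = ≡.refl
  Σ≡sum {suc k} f = ≡.cong (f zero +_) (Σ≡sum (f ∘ suc))

  Σ-cong : ∀ {k} {f g : Fin k → Carrier} → (∀ i → f i ≈ g i) → Σ[< k ] f ≈ Σ[< k ] g
  Σ-cong {f = f} {g} f≈g = begin
    Σ[< _ ] f ≡⟨ Σ≡sum f ⟩
    sum f     ≈⟨ sum-cong-≋ f≈g ⟩
    sum g     ≡⟨ Σ≡sum g ⟨
    Σ[< _ ] g ∎

  Σ-zero : ∀ k → Σ[< k ] (λ _ → 0#) ≈ 0#
  Σ-zero k = trans (reflexive (Σ≡sum {k} (λ _ → 0#))) (sum-replicate-zero k)

  Σ-comm : ∀ {a b} (f : Fin a → Fin b → Carrier) →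
           Σ[< a ] (λ i → Σ[< b ] (f i)) ≈ Σ[< b ] (λ j → Σ[< a ] (λ i → f i j))
  Σ-comm f = begin
    Σ[< _ ] (λ i → Σ[< _ ] (f i))
      ≡⟨ ≡.trans (Σ≡sum (λ i → Σ[< _ ] (f i))) (sum-cong-≗ (Σ≡sum ∘ f)) ⟩
    sum (λ i → sum (f i))
      ≈⟨ ∑-comm f ⟩
    sum (λ j → sum (λ i → f i j))
      ≡⟨ ≡.trans (Σ≡sum (λ j → Σ[< _ ] (λ i → f i j))) (sum-cong-≗ (λ j → Σ≡sum (λ i → f i j))) ⟨
    Σ[< _ ] (λ j → Σ[< _ ] (λ i → f i j)) ∎

  *-distribˡ-Σ : ∀ {k} x (f : Fin k → Carrier) → x * Σ[< k ] f ≈ Σ[< k ] (λ i → x * f i)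
  *-distribˡ-Σ x f = begin
    x * Σ[< _ ] f            ≡⟨ ≡.cong (x *_) (Σ≡sum f) ⟩
    x * sum f                ≈⟨ *-distribˡ-sum x f ⟩
    sum (λ i → x * f i)      ≡⟨ Σ≡sum (λ i → x * f i) ⟨
    Σ[< _ ] (λ i → x * f i)  ∎

  *-distribʳ-Σ : ∀ {k} x (f : Fin k → Carrier) → Σ[< k ] f * x ≈ Σ[< k ] (λ i → f i * x)
  *-distribʳ-Σ x f = begin
    Σ[< _ ] f * x            ≡⟨ ≡.cong (_* x) (Σ≡sum f) ⟩
    sum f * x                ≈⟨ *-distribʳ-sum x f ⟩
    sum (λ i → f i * x)      ≡⟨ Σ≡sum (λ i → f i * x) ⟨
    Σ[< _ ] (λ i → f i * x)  ∎

  Σ-δ : ∀ {k} (a : Fin k) (f : Fin k → Carrier) →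
        Σ[< k ] (λ i → if does (a ≟ i) then f i else 0#) ≈ f a
  Σ-δ {suc k} zero    f = trans (+-congˡ (Σ-zero k)) (+-identityʳ (f zero))
  Σ-δ {suc k} (suc a) f = trans (+-identityˡ _) (Σ-δ a (f ∘ suc))

  Σ-δ′ : ∀ {k} (a : Fin k) (f : Fin k → Carrier) →
         Σ[< k ] (λ i → if does (i ≟ a) then f i else 0#) ≈ f a
  Σ-δ′ a f = trans (Σ-cong (λ i → reflexive (if-cong (does-≟-sym i a)))) (Σ-δ a f)

  if-*ˡ : ∀ b x y → x * (if b then y else 0#) ≈ (if b then x * y else 0#)
  if-*ˡ true  x y = refl
  if-*ˡ false x y = zeroʳ x

  if-*ʳ : ∀ b x y → (if b then x else 0#) * y ≈ (if b then x * y else 0#)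
  if-*ʳ true  x y = refl
  if-*ʳ false x y = zeroˡ y

  if-zero : ∀ b {x} → x ≈ 0# → (if b then x else 0#) ≈ 0#
  if-zero true  x≈0 = x≈0
  if-zero false x≈0 = refl

  vanishing-products : ∀ {a x b y} → a ≈ 0# → y ≈ 0# → a * x ≈ b * y
  vanishing-products a≈0 y≈0 = trans (*-congʳ a≈0) (trans (zeroˡ _) (sym (trans (*-congˡ y≈0) (zeroʳ _))))

  sumL-++ : ∀ xs ys → sumL (xs ++ ys) ≈ sumL xs + sumL ys
  sumL-++ []       ys = sym (+-identityˡ (sumL ys))
  sumL-++ (x ∷ xs) ys = trans (+-congˡ (sumL-++ xs ys)) (sym (+-assoc x (sumL xs) (sumL ys)))

  sumL-map-cong : ∀ {A : Set} {f g : A → Carrier} → (∀ x → f x ≈ g x) →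
                  ∀ xs → sumL (map f xs) ≈ sumL (map g xs)
  sumL-map-cong f≈g []       = refl
  sumL-map-cong f≈g (x ∷ xs) = +-cong (f≈g x) (sumL-map-cong f≈g xs)

  sumL-map-zero : ∀ {A : Set} (xs : List A) → sumL (map (λ _ → 0#) xs) ≈ 0#
  sumL-map-zero []       = refl
  sumL-map-zero (a ∷ xs) = trans (+-identityˡ _) (sumL-map-zero xs)

  sumL-map-then : ∀ {A : Set} b (f : A → Carrier) xs →
                  sumL (map (λ a → if b then f a else 0#) xs) ≈ (if b then sumL (map f xs) else 0#)
  sumL-map-then true  f xs = refl
  sumL-map-then false f xs = sumL-map-zero xs

  sumL-map-else : ∀ {A : Set} b (f : A → Carrier) xs →
                  sumL (map (λ a → if b then 0# else f a) xs) ≈ (if b then 0# else sumL (map f xs))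
  sumL-map-else true  f xs = sumL-map-zero xs
  sumL-map-else false f xs = refl

  *-distribˡ-sumL : ∀ {A : Set} x (f : A → Carrier) xs →
                    x * sumL (map f xs) ≈ sumL (map (λ a → x * f a) xs)
  *-distribˡ-sumL x f []       = zeroʳ x
  *-distribˡ-sumL x f (a ∷ xs) = trans (distribˡ x (f a) _) (+-congˡ (*-distribˡ-sumL x f xs))

  sumL-filter : ∀ {A : Set} {q} {Q : A → Set q} (Q? : Decidable Q) (f : A → Carrier) xs →
                sumL (map f (filter Q? xs)) ≈ sumL (map (λ a → if does (Q? a) then f a else 0#) xs)
  sumL-filter Q? f []       = refl
  sumL-filter Q? f (a ∷ xs) with does (Q? a)
  ... | true  = +-congˡ (sumL-filter Q? f xs)
  ... | false = trans (sumL-filter Q? f xs) (sym (+-identityˡ _))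

  sumL-concatMap : ∀ {A B : Set} (f : B → Carrier) (g : A → List B) xs →
                   sumL (map f (concatMap g xs)) ≈ sumL (map (λ a → sumL (map f (g a))) xs)
  sumL-concatMap f g []       = refl
  sumL-concatMap f g (a ∷ xs) = begin
    sumL (map f (g a ++ concatMap g xs))              ≡⟨ ≡.cong sumL (map-++ f (g a) (concatMap g xs)) ⟩
    sumL (map f (g a) ++ map f (concatMap g xs))      ≈⟨ sumL-++ (map f (g a)) _ ⟩
    sumL (map f (g a)) + sumL (map f (concatMap g xs)) ≈⟨ +-congˡ (sumL-concatMap f g xs) ⟩
    sumL (map f (g a)) + sumL (map (λ a → sumL (map f (g a))) xs) ∎

  sumL-tabulate : ∀ {k} (f : Fin k → Carrier) → sumL (tabulate f) ≡ Σ[< k ] f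
  sumL-tabulate {zero}  f = ≡.refl
  sumL-tabulate {suc k} f = ≡.cong (f zero +_) (sumL-tabulate (f ∘ suc))

  sumL-allFin : ∀ k (f : Fin k → Carrier) → sumL (map f (allFin k)) ≡ Σ[< k ] f
  sumL-allFin k f = ≡.trans (≡.cong sumL (map-tabulate id f)) (sumL-tabulate f)

module Matrices {c ℓ} (ℛ : CommutativeRing c ℓ) where
  open CommutativeRing ℛ hiding (zero)
  open WithRing ℛ
  open Summation ℛ
  open import Relation.Binary.Reasoning.Setoid setoid

  diag : ∀ {k} → (Fin k → Carrier) → Mat k k
  diag d i j = if does (i ≟ j) then d i else 0#

  diag-⊗ : ∀ {k b} (d : Fin k → Carrier) (Y : Mat k b) i j → (diag d ⊗ Y) i j ≈ d i * Y i j
  diag-⊗ d Y i j = begin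
    Σ[< _ ] (λ l → (if does (i ≟ l) then d i else 0#) * Y l j)  ≈⟨ Σ-cong (λ l → if-*ʳ (does (i ≟ l)) (d i) (Y l j)) ⟩
    Σ[< _ ] (λ l → if does (i ≟ l) then d i * Y l j else 0#)    ≈⟨ Σ-δ i (λ l → d i * Y l j) ⟩
    d i * Y i j                                                ∎

  ⊗-assoc : ∀ {a b d e} (P : Mat a b) (Q : Mat b d) (Y : Mat d e) → ((P ⊗ Q) ⊗ Y) ≋ (P ⊗ (Q ⊗ Y))
  ⊗-assoc P Q Y i j = begin
    Σ[< _ ] (λ l → Σ[< _ ] (λ h → P i h * Q h l) * Y l j)   ≈⟨ Σ-cong (λ l → *-distribʳ-Σ (Y l j) (λ h → P i h * Q h l)) ⟩
    Σ[< _ ] (λ l → Σ[< _ ] (λ h → P i h * Q h l * Y l j))   ≈⟨ Σ-comm (λ l h → P i h * Q h l * Y l j) ⟩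
    Σ[< _ ] (λ h → Σ[< _ ] (λ l → P i h * Q h l * Y l j))   ≈⟨ Σ-cong (λ h → Σ-cong (λ l → *-assoc (P i h) (Q h l) (Y l j))) ⟩
    Σ[< _ ] (λ h → Σ[< _ ] (λ l → P i h * (Q h l * Y l j))) ≈⟨ Σ-cong (λ h → *-distribˡ-Σ (P i h) (λ l → Q h l * Y l j)) ⟨
    Σ[< _ ] (λ h → P i h * Σ[< _ ] (λ l → Q h l * Y l j))   ∎

module Walks {c ℓ} (ℛ : CommutativeRing c ℓ) {n} (G : WithRing.WeightedDigraph ℛ n) where
  open CommutativeRing ℛ hiding (zero)
  open WithRing ℛ
  open WeightedDigraph G
  open Summation ℛ
  open import Relation.Binary.Reasoning.Setoid setoid

  adj-edge : ∀ e → adj G (src e) (tgt e) ≈ w e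
  adj-edge e = trans (Σ-cong only-e) (Σ-δ e w)
    where
    only-e : ∀ f → (if does (src f ≟ src e) ∧ does (tgt f ≟ tgt e) then w f else 0#)
                   ≈ (if does (e ≟ f) then w f else 0#)
    only-e f with e ≟ f
    ... | yes ≡.refl rewrite dec-true (src e ≟ src e) ≡.refl | dec-true (tgt e ≟ tgt e) ≡.refl = refl
    ... | no e≢f with src f ≟ src e | tgt f ≟ tgt e
    ...   | yes s≡ | yes t≡ = ⊥-elim (e≢f (≡.sym (simple f e s≡ t≡)))
    ...   | yes _  | no _   = refl
    ...   | no _   | _      = refl

  adj-¬IsEdge : ∀ {x y} → ¬ IsEdge G x y → adj G x y ≈ 0#
  adj-¬IsEdge {x} {y} ¬edge = trans (Σ-cong no-e) (Σ-zero m)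
    where
    no-e : ∀ e → (if does (src e ≟ x) ∧ does (tgt e ≟ y) then w e else 0#) ≈ 0#
    no-e e with src e ≟ x | tgt e ≟ y
    ... | yes s≡ | yes t≡ = ⊥-elim (¬edge (e , s≡ , t≡))
    ... | yes _  | no _   = refl
    ... | no _   | _      = refl

  walkWeight-if-isWalk : ∀ {l} (v : Vec (Fin n) l) →
                         (if does (isWalk? G v) then walkWeight G v else 0#) ≈ walkWeight G v
  walkWeight-if-isWalk []          = refl
  walkWeight-if-isWalk (x ∷ [])    = refl
  walkWeight-if-isWalk (x ∷ y ∷ r) = prepend (isEdge? G x y) (walkWeight-if-isWalk (y ∷ r))
    where
    b = does (isWalk? G (y ∷ r))
    u = walkWeight G (y ∷ r)
    prepend : (edge? : Dec (IsEdge G x y)) → (if b then u else 0#) ≈ u →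
              (if does edge? ∧ b then adj G x y * u else 0#) ≈ adj G x y * u
    prepend (yes _)    b·u≈u = trans (sym (if-*ˡ b _ u)) (*-congˡ b·u≈u)
    prepend (no ¬edge) _     = sym (trans (*-congʳ (adj-¬IsEdge ¬edge)) (zeroˡ u))

  walkWeight-¬IsWalk : ∀ {l} (v : Vec (Fin n) l) → ¬ IsWalk G v → walkWeight G v ≈ 0#
  walkWeight-¬IsWalk v ¬walk = trans (sym (walkWeight-if-isWalk v))
    (reflexive (if-cong (dec-false (isWalk? G v) ¬walk)))

  Σ-adj-by-edges : ∀ x (F : Fin n → Fin n → Carrier) →
          Σ[< n ] (λ y → adj G x y * F x y) ≈ Σ[< m ] (λ e → Lmat G e x * (w e * F (src e) (tgt e)))
  Σ-adj-by-edges x F = begin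
    Σ[< n ] (λ y → adj G x y * F x y)           ≈⟨ Σ-cong (λ y → *-distribʳ-Σ (F x y) (edgeAt y)) ⟩
    Σ[< n ] (λ y → Σ[< m ] (λ e → edgeAt y e * F x y)) ≈⟨ Σ-comm (λ y e → edgeAt y e * F x y) ⟩
    Σ[< m ] (λ e → Σ[< n ] (λ y → edgeAt y e * F x y)) ≈⟨ Σ-cong collapse ⟩
    Σ[< m ] (λ e → Lmat G e x * (w e * F (src e) (tgt e))) ∎
    where
    edgeAt : Fin n → Fin m → Carrier
    edgeAt y e = if does (src e ≟ x) ∧ does (tgt e ≟ y) then w e else 0#
    collapse : ∀ e → Σ[< n ] (λ y → edgeAt y e * F x y) ≈ Lmat G e x * (w e * F (src e) (tgt e))
    collapse e with src e ≟ x
    ... | no _ = trans (Σ-cong (λ y → zeroˡ (F x y))) (trans (Σ-zero n) (sym (zeroˡ _)))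
    ... | yes ≡.refl = begin
      Σ[< n ] (λ y → (if does (tgt e ≟ y) then w e else 0#) * F (src e) y) ≈⟨ Σ-cong (λ y → if-*ʳ (does (tgt e ≟ y)) (w e) (F (src e) y)) ⟩
      Σ[< n ] (λ y → if does (tgt e ≟ y) then w e * F (src e) y else 0#)  ≈⟨ Σ-δ (tgt e) (λ y → w e * F (src e) y) ⟩
      w e * F (src e) (tgt e)                                             ≈⟨ *-identityˡ _ ⟨
      1# * (w e * F (src e) (tgt e))                                      ∎

  sumSeqs : ∀ l → (Vec (Fin n) l → Carrier) → Carrier
  sumSeqs l f = sumL (map f (allSeqs G l))

  sumSeqs-cong : ∀ l {f g : Vec (Fin n) l → Carrier} → (∀ v → f v ≈ g v) → sumSeqs l f ≈ sumSeqs l g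
  sumSeqs-cong l f≈g = sumL-map-cong f≈g (allSeqs G l)

  sumSeqs-suc : ∀ l (f : Vec (Fin n) (suc l) → Carrier) →
                sumSeqs (suc l) f ≈ Σ[< n ] (λ x → sumSeqs l (f ∘ (x ∷_)))
  sumSeqs-suc l f = begin
    sumL (map f (concatMap (λ x → map (x ∷_) (allSeqs G l)) (allFin n)))
      ≈⟨ sumL-concatMap f (λ x → map (x ∷_) (allSeqs G l)) (allFin n) ⟩
    sumL (map (λ x → sumL (map f (map (x ∷_) (allSeqs G l)))) (allFin n))
      ≡⟨ ≡.cong sumL (map-cong (λ x → ≡.cong sumL (≡.sym (map-∘ (allSeqs G l)))) (allFin n)) ⟩
    sumL (map (λ x → sumSeqs l (f ∘ (x ∷_))) (allFin n))
      ≡⟨ sumL-allFin n (λ x → sumSeqs l (f ∘ (x ∷_))) ⟩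
    Σ[< n ] (λ x → sumSeqs l (f ∘ (x ∷_))) ∎

  nbEndingAt : Fin n → ∀ {l} → Vec (Fin n) (suc l) → Bool
  nbEndingAt j v = does (last v ≟ j) ∧ does (nonBacktracking? G v)

  -- nbTailSum l x₀ x₁ j is N_l(x₀, x₁, j): the weight of x₀ → x₁ is not counted, and
  -- sequences that are not walks need no filter since their weight vanishes.
  nbTail : Fin n → Fin n → Fin n → ∀ {l} → Vec (Fin n) l → Carrier
  nbTail x₀ x₁ j r = if nbEndingAt j (x₀ ∷ x₁ ∷ r) then walkWeight G (x₁ ∷ r) else 0#

  nbTailSum : ℕ → Fin n → Fin n → Fin n → Carrier
  nbTailSum l x₀ x₁ j = sumSeqs l (nbTail x₀ x₁ j)

  nbTailSum-zero : ∀ x₀ x₁ j → nbTailSum 0 x₀ x₁ j ≈ (if does (x₁ ≟ j) then 1# else 0#)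
  nbTailSum-zero x₀ x₁ j = trans (+-identityʳ _) (reflexive (if-cong (∧-identityʳ (does (x₁ ≟ j)))))

  nbTail-cons : ∀ x₀ x₁ j y {l} (r : Vec (Fin n) l) →
                nbTail x₀ x₁ j (y ∷ r) ≈ adj G x₁ y * (if does (x₀ ≟ y) then 0# else nbTail x₁ y j r)
  nbTail-cons x₀ x₁ j y r with does (x₀ ≟ y) | does (last (y ∷ r) ≟ j)
  ... | true  | true  = sym (zeroʳ _)
  ... | true  | false = sym (zeroʳ _)
  ... | false | _     = sym (if-*ˡ _ _ _)

  nbTailSum-suc : ∀ l x₀ x₁ j → nbTailSum (suc l) x₀ x₁ j
                  ≈ Σ[< n ] (λ y → adj G x₁ y * (if does (x₀ ≟ y) then 0# else nbTailSum l x₁ y j))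
  nbTailSum-suc l x₀ x₁ j = trans (sumSeqs-suc l (nbTail x₀ x₁ j)) (Σ-cong first-step)
    where
    first-step : ∀ y → sumSeqs l (λ r → nbTail x₀ x₁ j (y ∷ r))
                       ≈ adj G x₁ y * (if does (x₀ ≟ y) then 0# else nbTailSum l x₁ y j)
    first-step y = begin
      sumSeqs l (λ r → nbTail x₀ x₁ j (y ∷ r))
        ≈⟨ sumSeqs-cong l (nbTail-cons x₀ x₁ j y) ⟩
      sumSeqs l (λ r → adj G x₁ y * (if does (x₀ ≟ y) then 0# else nbTail x₁ y j r))
        ≈⟨ *-distribˡ-sumL (adj G x₁ y) _ (allSeqs G l) ⟨
      adj G x₁ y * sumSeqs l (λ r → if does (x₀ ≟ y) then 0# else nbTail x₁ y j r)
        ≈⟨ *-congˡ (sumL-map-else (does (x₀ ≟ y)) (nbTail x₁ y j) (allSeqs G l)) ⟩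
      adj G x₁ y * (if does (x₀ ≟ y) then 0# else nbTailSum l x₁ y j) ∎

  pMat-from : ∀ k i j → pMat G k i j ≈ sumSeqs k (λ v → if nbEndingAt j (i ∷ v) then walkWeight G (i ∷ v) else 0#)
  pMat-from k i j = begin
    pMat G k i j
      ≈⟨ sumL-filter D (walkWeight G) (allSeqs G (suc k)) ⟩
    sumSeqs (suc k) (λ v → if does (D v) then walkWeight G v else 0#)
      ≈⟨ sumSeqs-cong (suc k) drop-isWalk ⟩
    sumSeqs (suc k) (λ v → if does (head v ≟ i) ∧ nbEndingAt j v then walkWeight G v else 0#)
      ≈⟨ sumSeqs-suc k _ ⟩
    Σ[< n ] (λ x → sumSeqs k (λ v → if does (x ≟ i) ∧ nbEndingAt j (x ∷ v) then walkWeight G (x ∷ v) else 0#))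
      ≈⟨ Σ-cong (λ x → sumSeqs-cong k (λ v → reflexive (if-∧ (does (x ≟ i))))) ⟩
    Σ[< n ] (λ x → sumSeqs k (λ v → if does (x ≟ i) then from x v else 0#))
      ≈⟨ Σ-cong (λ x → sumL-map-then (does (x ≟ i)) (from x) (allSeqs G k)) ⟩
    Σ[< n ] (λ x → if does (x ≟ i) then sumSeqs k (from x) else 0#)
      ≈⟨ Σ-δ′ i (λ x → sumSeqs k (from x)) ⟩
    sumSeqs k (from i) ∎
    where
    D = λ v → (head v ≟ i) ×-dec ((last v ≟ j) ×-dec (isWalk? G v ×-dec nonBacktracking? G v))
    from : Fin n → Vec (Fin n) k → Carrier
    from x v = if nbEndingAt j (x ∷ v) then walkWeight G (x ∷ v) else 0#
    drop-isWalk : ∀ v → (if does (D v) then walkWeight G v else 0#)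
                        ≈ (if does (head v ≟ i) ∧ nbEndingAt j v then walkWeight G v else 0#)
    drop-isWalk v with isWalk? G v
    ... | yes _    = refl
    ... | no ¬walk = trans (if-zero _ ww≈0) (sym (if-zero _ ww≈0))
      where ww≈0 = walkWeight-¬IsWalk v ¬walk

  pMat-nbTailSum : ∀ k i j → pMat G (suc k) i j ≈ Σ[< n ] (λ y → adj G i y * nbTailSum k i y j)
  pMat-nbTailSum k i j = begin
    pMat G (suc k) i j
      ≈⟨ pMat-from (suc k) i j ⟩
    sumSeqs (suc k) (λ v → if nbEndingAt j (i ∷ v) then walkWeight G (i ∷ v) else 0#)
      ≈⟨ sumSeqs-suc k _ ⟩
    Σ[< n ] (λ y → sumSeqs k (λ r → if nbEndingAt j (i ∷ y ∷ r) then adj G i y * walkWeight G (y ∷ r) else 0#))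
      ≈⟨ Σ-cong (λ y → sumSeqs-cong k (λ r → sym (if-*ˡ (nbEndingAt j (i ∷ y ∷ r)) (adj G i y) _))) ⟩
    Σ[< n ] (λ y → sumSeqs k (λ r → adj G i y * nbTail i y j r))
      ≈⟨ Σ-cong (λ y → *-distribˡ-sumL (adj G i y) (nbTail i y j) (allSeqs G k)) ⟨
    Σ[< n ] (λ y → adj G i y * nbTailSum k i y j) ∎

module SqrtHashimoto {c ℓ} (ℛ : CommutativeRing c ℓ) where
  open CommutativeRing ℛ hiding (zero)
  open WithRing ℛ
  open Summation ℛ
  open Matrices ℛ
  open import Relation.Binary.Reasoning.Setoid setoid

  module Powers {p} (Pos : Carrier → Set p) (√ : Carrier → Carrier)
               (√-cong : ∀ a b → a ≈ b → √ a ≈ √ b) (√-0 : √ 0# ≈ 0#)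
               (√-* : ∀ a b → Pos a → Pos b → √ (a * b) ≈ √ a * √ b)
               (√-sq : ∀ a → Pos a → √ a * √ a ≈ a)
               {n} (G : WeightedDigraph n) (pos : ∀ e → Pos (WeightedDigraph.w G e)) where
    open WeightedDigraph G
    open Walks ℛ G

    √w : Fin m → Carrier
    √w e = √ (adj G (src e) (tgt e))

    √w-edge : ∀ e → √w e ≈ √ (w e)
    √w-edge e = √-cong _ _ (adj-edge e)

    √w*√w : ∀ e → √w e * √w e ≈ w e
    √w*√w e = trans (*-cong (√w-edge e) (√w-edge e)) (√-sq (w e) (pos e))

    √-adj*adj : ∀ e f → √ (adj G (src e) (tgt e) * adj G (src f) (tgt f)) ≈ √w e * √w f
    √-adj*adj e f = begin
      √ (adj G (src e) (tgt e) * adj G (src f) (tgt f)) ≈⟨ √-cong _ _ (*-cong (adj-edge e) (adj-edge f)) ⟩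
      √ (w e * w f)                                     ≈⟨ √-* (w e) (w f) (pos e) (pos f) ⟩
      √ (w e) * √ (w f)                                 ≈⟨ *-cong (√w-edge e) (√w-edge f) ⟨
      √w e * √w f                                       ∎

    √B-entry : ∀ e f → elementwise √ (Bmat G) e f
               ≈ (if does (src f ≟ tgt e) then (if does (src e ≟ tgt f) then 0# else √w e * √w f) else 0#)
    √B-entry e f rewrite does-≟-sym (tgt e) (src f) | does-≟-sym (tgt f) (src e)
      with does (src f ≟ tgt e) | does (src e ≟ tgt f)
    ... | true  | true  = √-0
    ... | true  | false = √-adj*adj e f
    ... | false | _     = √-0

    √B*√w : ∀ e f x → elementwise √ (Bmat G) e f * (√w f * x)
              ≈ √w e * (Lmat G f (tgt e) * (w f * (if does (src e ≟ tgt f) then 0# else x)))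
    √B*√w e f x with does (src f ≟ tgt e) | does (src e ≟ tgt f) | √B-entry e f
    ... | false | _     | √B≈0 = vanishing-products √B≈0 (zeroˡ _)
    ... | true  | true  | √B≈0 = vanishing-products √B≈0 (trans (*-identityˡ _) (zeroʳ _))
    ... | true  | false | √B≈ = begin
      elementwise √ (Bmat G) e f * (√w f * x) ≈⟨ *-congʳ √B≈ ⟩
      (√w e * √w f) * (√w f * x)             ≈⟨ *-assoc _ _ _ ⟩
      √w e * (√w f * (√w f * x))             ≈⟨ *-congˡ (*-assoc _ _ _) ⟨
      √w e * ((√w f * √w f) * x)             ≈⟨ *-congˡ (*-congʳ (√w*√w f)) ⟩
      √w e * (w f * x)                       ≈⟨ *-congˡ (*-identityˡ _) ⟨
      √w e * (1# * (w f * x))                ∎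

    √B^k√ZR-entry : ∀ k e j → ((elementwise √ (Bmat G) ^^ k) ⊗ (sqrtZ G √ ⊗ Rmat G)) e j
                          ≈ √w e * nbTailSum k (src e) (tgt e) j
    √B^k√ZR-entry zero e j = begin
      (idMat ⊗ (diag √w ⊗ Rmat G)) e j ≈⟨ diag-⊗ (λ _ → 1#) (diag √w ⊗ Rmat G) e j ⟩
      1# * (diag √w ⊗ Rmat G) e j     ≈⟨ *-identityˡ _ ⟩
      (diag √w ⊗ Rmat G) e j          ≈⟨ diag-⊗ √w (Rmat G) e j ⟩
      √w e * Rmat G e j               ≈⟨ *-congˡ (nbTailSum-zero (src e) (tgt e) j) ⟨
      √w e * nbTailSum 0 (src e) (tgt e) j ∎
    √B^k√ZR-entry (suc k) e j = begin
      ((√B ⊗ (√B ^^ k)) ⊗ X) e j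
        ≈⟨ ⊗-assoc √B (√B ^^ k) X e j ⟩
      Σ[< m ] (λ f → √B e f * ((√B ^^ k) ⊗ X) f j)
        ≈⟨ Σ-cong (λ f → *-congˡ (√B^k√ZR-entry k f j)) ⟩
      Σ[< m ] (λ f → √B e f * (√w f * nbTailSum k (src f) (tgt f) j))
        ≈⟨ Σ-cong (λ f → √B*√w e f (nbTailSum k (src f) (tgt f) j)) ⟩
      Σ[< m ] (λ f → √w e * (Lmat G f (tgt e) * (w f * F (src f) (tgt f))))
        ≈⟨ *-distribˡ-Σ (√w e) (λ f → Lmat G f (tgt e) * (w f * F (src f) (tgt f))) ⟨
      √w e * Σ[< m ] (λ f → Lmat G f (tgt e) * (w f * F (src f) (tgt f)))
        ≈⟨ *-congˡ (Σ-adj-by-edges (tgt e) F) ⟨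
      √w e * Σ[< n ] (λ y → adj G (tgt e) y * F (tgt e) y)
        ≈⟨ *-congˡ (nbTailSum-suc k (src e) (tgt e) j) ⟨
      √w e * nbTailSum (suc k) (src e) (tgt e) j ∎
      where
      √B = elementwise √ (Bmat G)
      X = sqrtZ G √ ⊗ Rmat G
      F : Fin n → Fin n → Carrier
      F x y = if does (src e ≟ y) then 0# else nbTailSum k x y j

theorem4p5 : ∀ {c ℓ p : Level} (ℛ : CommutativeRing c ℓ) →
    let open CommutativeRing ℛ
        open WithRing ℛ
    in (Pos : Carrier → Set p) (√ : Carrier → Carrier) →
       (∀ a b → a ≈ b → √ a ≈ √ b) →
       √ 0# ≈ 0# →
       (∀ a b → Pos a → Pos b → √ (a * b) ≈ √ a * √ b) →
       (∀ a → Pos a → √ a * √ a ≈ a) →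
       ∀ {n} (G : WeightedDigraph n) →
       (∀ e → Pos (WeightedDigraph.w G e)) →
       ∀ (k : ℕ) →
       (transpose (Lmat G) ⊗ (sqrtZ G √ ⊗ ((elementwise √ (Bmat G) ^^ k) ⊗ (sqrtZ G √ ⊗ Rmat G))))
         ≋ pMat G (suc k)
theorem4p5 ℛ Pos √ √-cong √-0 √-* √-sq {n} G pos k i j = begin
  Σ[< m ] (λ e → Lmat G e i * (diag √w ⊗ M) e j)
    ≈⟨ Σ-cong (λ e → *-congˡ (diag-⊗ √w M e j)) ⟩
  Σ[< m ] (λ e → Lmat G e i * (√w e * M e j))
    ≈⟨ Σ-cong (λ e → *-congˡ (*-congˡ (√B^k√ZR-entry k e j))) ⟩
  Σ[< m ] (λ e → Lmat G e i * (√w e * (√w e * N (src e) (tgt e))))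
    ≈⟨ Σ-cong (λ e → *-congˡ (trans (sym (*-assoc _ _ _)) (*-congʳ (√w*√w e)))) ⟩
  Σ[< m ] (λ e → Lmat G e i * (w e * N (src e) (tgt e)))
    ≈⟨ Σ-adj-by-edges i N ⟨
  Σ[< n ] (λ y → adj G i y * N i y)
    ≈⟨ pMat-nbTailSum k i j ⟨
  pMat G (suc k) i j ∎
  where
  open CommutativeRing ℛ hiding (zero)
  open WithRing ℛ
  open WeightedDigraph G
  open Summation ℛ
  open Matrices ℛ
  open Walks ℛ G
  open SqrtHashimoto.Powers ℛ Pos √ √-cong √-0 √-* √-sq G pos
  open import Relation.Binary.Reasoning.Setoid setoid
  M = (elementwise √ (Bmat G) ^^ k) ⊗ (sqrtZ G √ ⊗ Rmat G)
  N = λ x y → nbTailSum k x y j
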